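{- For every odd integer $k\ge 1$, $M_{k,\mathrm{T}\cdots\mathrm{F}}\le\sqrt{2}^{\,k+1}$.
   Context: Unordered CNF game: an instance is a pair $(\varphi,X)$ where $\varphi$ is a CNF formula (a set of clauses, each clause a disjunction of literals $x_i$ or $\overline{x}_i$) and $X$ is a finite set of boolean variables containing every variable appearing in $\varphi$. Two players, T and F, alternate turns; on each turn the player picks a not-yet-assigned variable from $X$ and assigns it $0$ or $1$. The game ends when all variables are assigned; T wins if $\varphi$ is satisfied and F wins otherwise. A CNF is $k$-uniform if every clause has exactly $k$ literals, on $k$ distinct variables. $M_{k,\mathrm{T}\cdots\mathrm{F}}$ denotes the minimum number of clauses of $\varphi$ over all instances $(\varphi,X)$ with $\varphi$ $k$-uniform and $|X|$ even such that F has a winning strategy when T moves first (so F moves last). -}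

module Defs where

open import Data.Nat using (ℕ; _+_; _*_)
open import Data.Bool using (Bool)
open import Data.Fin using (Fin; _≟_)
open import Data.Maybe using (Maybe; just; nothing)
open import Data.Product using (_×_; _,_; proj₁; ∃; ∃-syntax)
open import Data.List using (List; length; map)
open import Data.List.Relation.Unary.All using (All)
open import Data.List.Relation.Unary.Any using (Any)
open import Data.List.Relation.Unary.Unique.Propositional using (Unique)
open import Relation.Binary.PropositionalEquality using (_≡_; _≢_)
open import Relation.Nullary using (¬_; yes; no)

Even : ℕ → Set
Even n = ∃[ j ] n ≡ 2 * j

Odd : ℕ → Set
Odd n = ∃[ j ] n ≡ 2 * j + 1

-- Variables are Fin n (the set X, |X| = n).
-- A literal (i , true) is x_i, (i , false) is the negation of x_i.
Literal : ℕ → Set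
Literal n = Fin n × Bool

Clause : ℕ → Set
Clause n = List (Literal n)

CNF : ℕ → Set
CNF n = List (Clause n)

Uniform : ∀ {n} → ℕ → CNF n → Set
Uniform k φ = All (λ C → length C ≡ k × Unique (map proj₁ C)) φ

PAssign : ℕ → Set
PAssign n = Fin n → Maybe Bool

empty : ∀ {n} → PAssign n
empty _ = nothing

assign : ∀ {n} → PAssign n → Fin n → Bool → PAssign n
assign a i b j with j ≟ i
... | yes _ = just b
... | no _ = a j

Full : ∀ {n} → PAssign n → Set
Full a = ∀ i → a i ≢ nothing

LitTrue : ∀ {n} → PAssign n → Literal n → Set
LitTrue a (i , b) = a i ≡ just b

Sat : ∀ {n} → CNF n → PAssign n → Set
Sat φ a = All (Any (LitTrue a)) φ

data Player : Set where
  T F : Player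

-- FWins φ p a : from position a with player p to move, F has a winning strategy.
data FWins {n : ℕ} (φ : CNF n) : Player → PAssign n → Set where
  finish : ∀ {p a} → Full a → ¬ Sat φ a → FWins φ p a
  fmove  : ∀ {a} (i : Fin n) (b : Bool) → a i ≡ nothing →
           FWins φ T (assign a i b) → FWins φ F a
  tmove  : ∀ {a} → ¬ Full a →
           (∀ (i : Fin n) (b : Bool) → a i ≡ nothing → FWins φ F (assign a i b)) →
           FWins φ T a

-- Group the 2t+2 variables into pairs (x₀,x₁), (x₂,x₃), … . F answers every move of T on a
-- variable by giving its partner the same value, so at the end each pair is constant. The
-- 2^(t+1) clauses ⋁ⱼ (x₂ⱼ^sⱼ ∨ x₂ⱼ₊₁^sⱼ), one per sign vector s, are then not all satisfied:
-- the clause whose signs oppose the values of the pairs is false. Deleting x₁ from every clause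
-- keeps this property and makes the formula (2t+1)-uniform, with (2^(t+1))² = 2^(k+1) for k = 2t+1.
module Submission where

open import Defs
open import Data.Nat using (ℕ; _≤_; _*_; _^_; _+_; zero; suc)
open import Data.Nat.Properties as ℕₚ using (+-suc; +-identityʳ; 1+n≢0; ≤-reflexive; ^-distribˡ-+-*)
open import Data.Nat.Tactic.RingSolver using (solve-∀)
open import Data.Bool using (Bool; true; false; not)
open import Data.Bool.Properties using (not-¬)
open import Data.Fin using (Fin; zero; suc; _≟_)
open import Data.Fin.Properties using (suc-injective)
open import Data.Maybe using (Maybe; just; nothing)
open import Data.Maybe.Properties using (just-injective)
open import Data.Product using (_×_; _,_; proj₁; map₁; ∃-syntax)
open import Data.Sum using (_⊎_; inj₁; inj₂)
open import Data.List using (List; []; _∷_; length; map; _++_)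
open import Data.List.Properties using (length-map; length-++; map-∘)
open import Data.List.Relation.Unary.All as All using (All; []; _∷_)
open import Data.List.Relation.Unary.All.Properties as AllP using (All¬⇒¬Any; Any¬⇒¬All)
open import Data.List.Relation.Unary.Any as Any using (Any; here)
import Data.List.Relation.Unary.Any.Properties as AnyP
open import Data.List.Relation.Unary.AllPairs using ([]; _∷_)
open import Data.List.Relation.Unary.Unique.Propositional using (Unique)
import Data.List.Relation.Unary.Unique.Propositional.Properties as Unique
open import Data.Empty using (⊥-elim)
open import Function using (_∘_)
open import Relation.Nullary using (¬_; Dec; yes; no)
open import Relation.Binary.PropositionalEquality

private
  variable
    n : ℕ

Falsified : PAssign n → Clause n → Set
Falsified a = All (¬_ ∘ LitTrue a)

falsified⇒¬Sat : ∀ {φ : CNF n} {a} → Any (Falsified a) φ → ¬ Sat φ a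
falsified⇒¬Sat = Any¬⇒¬All ∘ Any.map All¬⇒¬Any

UniformClause : ℕ → Clause n → Set
UniformClause k C = length C ≡ k × Unique (map proj₁ C)

assign-≡ : ∀ (a : PAssign n) i b → assign a i b i ≡ just b
assign-≡ a i b with i ≟ i
... | yes _ = refl
... | no i≢i = ⊥-elim (i≢i refl)

assign-≢ : ∀ (a : PAssign n) {i} b {j} → j ≢ i → assign a i b j ≡ a j
assign-≢ a {i} b {j} j≢i with j ≟ i
... | yes j≡i = ⊥-elim (j≢i j≡i)
... | no _ = refl

missing : Maybe Bool → ℕ
missing nothing = 1
missing (just _) = 0

unassigned : PAssign n → ℕ
unassigned {zero} a = 0
unassigned {suc n} a = missing (a zero) + unassigned (a ∘ suc)

unassigned≡0⇒Full : ∀ (a : PAssign n) → unassigned a ≡ 0 → Full a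
unassigned≡0⇒Full a none zero a₀≡nothing rewrite a₀≡nothing = 1+n≢0 none
unassigned≡0⇒Full a none (suc i) with a zero
... | just _ = unassigned≡0⇒Full (a ∘ suc) none i

Full⇒unassigned≡0 : ∀ (a : PAssign n) → Full a → unassigned a ≡ 0
Full⇒unassigned≡0 {zero} a full = refl
Full⇒unassigned≡0 {suc n} a full with a zero in a₀≡
... | nothing = ⊥-elim (full zero a₀≡)
... | just _ = Full⇒unassigned≡0 (a ∘ suc) (full ∘ suc)

unassigned-cong : ∀ {p q : PAssign n} → (∀ j → p j ≡ q j) → unassigned p ≡ unassigned q
unassigned-cong {zero} p≗q = refl
unassigned-cong {suc n} p≗q = cong₂ _+_ (cong missing (p≗q zero)) (unassigned-cong (p≗q ∘ suc))

unassigned-fill : ∀ {p q : PAssign n} i {v} → p i ≡ nothing → q i ≡ just v →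
                  (∀ j → j ≢ i → p j ≡ q j) → unassigned p ≡ suc (unassigned q)
unassigned-fill zero pᵢ qᵢ agree rewrite pᵢ | qᵢ =
  cong suc (unassigned-cong λ j → agree (suc j) λ ())
unassigned-fill {q = q} (suc i) pᵢ qᵢ agree rewrite agree zero λ () =
  trans (cong (missing (q zero) +_) (unassigned-fill i pᵢ qᵢ λ j j≢i → agree (suc j) (j≢i ∘ suc-injective)))
        (+-suc (missing (q zero)) _)

unassigned-assign : ∀ (a : PAssign n) {i} b → a i ≡ nothing → unassigned a ≡ suc (unassigned (assign a i b))
unassigned-assign a {i} b aᵢ = unassigned-fill i aᵢ (assign-≡ a i b) λ j j≢i → sym (assign-≢ a b j≢i)

Mirrored : (Fin n → Fin n) → PAssign n → Set
Mirrored partner a = ∀ i → a (partner i) ≡ a i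

module PairingStrategy {n : ℕ} (partner : Fin n → Fin n)
                       (partner-involutive : ∀ i → partner (partner i) ≡ i)
                       (partner-≢ : ∀ i → partner i ≢ i) where

  partner-injective : ∀ {i j} → partner i ≡ partner j → i ≡ j
  partner-injective {i} {j} eq =
    trans (sym (partner-involutive i)) (trans (cong partner eq) (partner-involutive j))

  mirror : PAssign n → Fin n → Bool → PAssign n
  mirror a i b = assign (assign a i b) (partner i) b

  mirror-hit : ∀ a i b {j} → j ≡ i ⊎ j ≡ partner i → mirror a i b j ≡ just b
  mirror-hit a i b (inj₁ refl) =
    trans (assign-≢ (assign a i b) b (partner-≢ i ∘ sym)) (assign-≡ a i b)
  mirror-hit a i b (inj₂ refl) = assign-≡ (assign a i b) (partner i) b

  mirror-miss : ∀ a i b {j} → j ≢ i → j ≢ partner i → mirror a i b j ≡ a j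
  mirror-miss a i b j≢i j≢i′ = trans (assign-≢ (assign a i b) b j≢i′) (assign-≢ a b j≢i)

  mirror-mirrored : ∀ {a} i b → Mirrored partner a → Mirrored partner (mirror a i b)
  mirror-mirrored {a} i b a-mirrored j = by-cases (j ≟ i) (j ≟ partner i)
    where
    hit = mirror-hit a i b
    by-cases : Dec (j ≡ i) → Dec (j ≡ partner i) → mirror a i b (partner j) ≡ mirror a i b j
    by-cases (yes j≡i) _ =
      trans (hit (inj₂ (cong partner j≡i))) (sym (hit (inj₁ j≡i)))
    by-cases (no _) (yes j≡i′) =
      trans (hit (inj₁ (trans (cong partner j≡i′) (partner-involutive i)))) (sym (hit (inj₂ j≡i′)))
    by-cases (no j≢i) (no j≢i′) =
      trans (mirror-miss a i b (λ eq → j≢i′ (trans (sym (partner-involutive j)) (cong partner eq)))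
                                (j≢i ∘ partner-injective))
            (trans (a-mirrored j) (sym (mirror-miss a i b j≢i j≢i′)))

  partner-unassigned : ∀ {a} i b → Mirrored partner a → a i ≡ nothing →
                       assign a i b (partner i) ≡ nothing
  partner-unassigned {a} i b a-mirrored aᵢ =
    trans (assign-≢ a b (partner-≢ i)) (trans (a-mirrored i) aᵢ)

  unassigned-mirror : ∀ {a} i b → Mirrored partner a → a i ≡ nothing →
                      unassigned a ≡ suc (suc (unassigned (mirror a i b)))
  unassigned-mirror {a} i b a-mirrored aᵢ =
    trans (unassigned-assign a b aᵢ)
          (cong suc (unassigned-assign (assign a i b) b (partner-unassigned i b a-mirrored aᵢ)))

  module _ (φ : CNF n) (mirrored-falsifies : ∀ a → Full a → Mirrored partner a → ¬ Sat φ a) where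

    mirrored-FWins : ∀ (c : ℕ) a → unassigned a ≡ c → Mirrored partner a → FWins φ T a
    mirrored-FWins zero a none a-mirrored =
      finish (unassigned≡0⇒Full a none) (mirrored-falsifies a (unassigned≡0⇒Full a none) a-mirrored)
    mirrored-FWins (suc c) a some a-mirrored =
      tmove (λ full → 1+n≢0 (trans (sym some) (Full⇒unassigned≡0 a full))) respond
      where
      continue : ∀ {a′} (c : ℕ) → suc (unassigned a′) ≡ c → Mirrored partner a′ → FWins φ T a′
      continue zero ()
      continue (suc c′) eq = mirrored-FWins c′ _ (ℕₚ.suc-injective eq)
      respond : ∀ i b → a i ≡ nothing → FWins φ F (assign a i b)
      respond i b aᵢ =
        fmove (partner i) b (partner-unassigned i b a-mirrored aᵢ)
              (continue c (ℕₚ.suc-injective (trans (sym (unassigned-mirror i b a-mirrored aᵢ)) some))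
                          (mirror-mirrored i b a-mirrored))

    FWins-empty : FWins φ T empty
    FWins-empty = mirrored-FWins _ empty refl λ _ → refl

twice : ℕ → ℕ
twice zero = zero
twice (suc m) = suc (suc (twice m))

twice≡2* : ∀ m → twice m ≡ 2 * m
twice≡2* zero = refl
twice≡2* (suc m) = trans (cong (2 +_) (twice≡2* m)) (cong suc (sym (+-suc m (m + 0))))

shiftVar : Fin n → Fin (suc (suc n))
shiftVar i = suc (suc i)

swapPairs : ∀ {m} → Fin (twice m) → Fin (twice m)
swapPairs {suc m} zero = suc zero
swapPairs {suc m} (suc zero) = zero
swapPairs {suc m} (suc (suc i)) = suc (suc (swapPairs i))

swapPairs-involutive : ∀ {m} (i : Fin (twice m)) → swapPairs (swapPairs i) ≡ i
swapPairs-involutive {suc m} zero = refl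
swapPairs-involutive {suc m} (suc zero) = refl
swapPairs-involutive {suc m} (suc (suc i)) = cong shiftVar (swapPairs-involutive i)

swapPairs-≢ : ∀ {m} (i : Fin (twice m)) → swapPairs i ≢ i
swapPairs-≢ {suc m} zero ()
swapPairs-≢ {suc m} (suc zero) ()
swapPairs-≢ {suc m} (suc (suc i)) eq = swapPairs-≢ i (suc-injective (suc-injective eq))

bothSigns : ∀ {A B : Set} → (Bool → A → B) → List A → List B
bothSigns f xs = map (f true) xs ++ map (f false) xs

module _ {A B : Set} (f : Bool → A → B) where

  length-bothSigns : ∀ xs → length (bothSigns f xs) ≡ 2 * length xs
  length-bothSigns xs = begin
    length (map (f true) xs ++ map (f false) xs)
      ≡⟨ length-++ (map (f true) xs) ⟩
    length (map (f true) xs) + length (map (f false) xs)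
      ≡⟨ cong₂ _+_ (length-map (f true) xs) (length-map (f false) xs) ⟩
    length xs + length xs
      ≡⟨ cong (length xs +_) (sym (+-identityʳ (length xs))) ⟩
    2 * length xs ∎
    where open ≡-Reasoning

  Any-bothSigns : ∀ {P : B → Set} {xs} s → Any P (map (f s) xs) → Any P (bothSigns f xs)
  Any-bothSigns true = AnyP.++⁺ˡ
  Any-bothSigns {xs = xs} false = AnyP.++⁺ʳ (map (f true) xs)

  All-bothSigns : ∀ {P : B → Set} {xs} → (∀ s → All P (map (f s) xs)) → All P (bothSigns f xs)
  All-bothSigns all = AllP.++⁺ (all true) (all false)

shift : Clause n → Clause (suc (suc n))
shift = map (map₁ shiftVar)

pairUp : Bool → Clause n → Clause (suc (suc n))
pairUp s C = (zero , s) ∷ (suc zero , s) ∷ shift C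

pairClauses : ∀ m → CNF (twice m)
pairClauses zero = [] ∷ []
pairClauses (suc m) = bothSigns pairUp (pairClauses m)

length-pairClauses : ∀ m → length (pairClauses m) ≡ 2 ^ m
length-pairClauses zero = refl
length-pairClauses (suc m) =
  trans (length-bothSigns pairUp (pairClauses m)) (cong (2 *_) (length-pairClauses m))

variables-shift : ∀ (C : Clause n) → map proj₁ (shift C) ≡ map shiftVar (map proj₁ C)
variables-shift C = trans (sym (map-∘ C)) (map-∘ C)

pairUp-uniform : ∀ {k} {C : Clause n} s → UniformClause k C → UniformClause (suc (suc k)) (pairUp s C)
pairUp-uniform {C = C} s (width , distinct) =
  cong (2 +_) (trans (length-map _ C) width) ,
  subst (λ vs → Unique (zero ∷ suc zero ∷ vs)) (sym (variables-shift C))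
        (((λ ()) ∷ zero-fresh) ∷ one-fresh ∷ Unique.map⁺ (suc-injective ∘ suc-injective) distinct)
  where
  zero-fresh : All (zero ≢_) (map shiftVar (map proj₁ C))
  zero-fresh = AllP.map⁺ (All.universal (λ _ ()) _)
  one-fresh : All (suc zero ≢_) (map shiftVar (map proj₁ C))
  one-fresh = AllP.map⁺ (All.universal (λ _ ()) _)

pairClauses-uniform : ∀ m → Uniform (twice m) (pairClauses m)
pairClauses-uniform zero = (refl , []) ∷ []
pairClauses-uniform (suc m) =
  All-bothSigns pairUp λ s → AllP.map⁺ (All.map (pairUp-uniform s) (pairClauses-uniform m))

pairClauses-falsified : ∀ m (a : PAssign (twice m)) → Full a → Mirrored swapPairs a →
                        Any (Falsified a) (pairClauses m)
pairClauses-falsified zero a _ _ = here []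
pairClauses-falsified (suc m) a full mirrored with a zero in a₀≡
... | nothing = ⊥-elim (full zero a₀≡)
... | just v = Any-bothSigns pairUp (not v) (AnyP.map⁺ (Any.map falsify-pair rest))
  where
  rest : Any (Falsified (a ∘ shiftVar)) (pairClauses m)
  rest = pairClauses-falsified m (a ∘ shiftVar) (full ∘ shiftVar) (mirrored ∘ shiftVar)
  contradicts : ∀ {i} → a i ≡ just v → ¬ a i ≡ just (not v)
  contradicts aᵢ aᵢ′ = not-¬ refl (just-injective (trans (sym aᵢ) aᵢ′))
  falsify-pair : ∀ {C} → Falsified (a ∘ shiftVar) C → Falsified a (pairUp (not v) C)
  falsify-pair falsified =
    contradicts a₀≡ ∷ contradicts (trans (mirrored zero) a₀≡) ∷ AllP.map⁺ falsified

dropSecond : ∀ {A : Set} → List A → List A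
dropSecond [] = []
dropSecond (x ∷ []) = x ∷ []
dropSecond (x ∷ _ ∷ xs) = x ∷ xs

All-dropSecond : ∀ {A : Set} {P : A → Set} {xs} → All P xs → All P (dropSecond xs)
All-dropSecond [] = []
All-dropSecond (p ∷ []) = p ∷ []
All-dropSecond (p ∷ _ ∷ ps) = p ∷ ps

dropSecond-uniform : ∀ {k} {C : Clause n} → UniformClause (suc (suc k)) C →
                     UniformClause (suc k) (dropSecond C)
dropSecond-uniform {C = []} (() , _)
dropSecond-uniform {C = _ ∷ []} (() , _)
dropSecond-uniform {C = _ ∷ _ ∷ _} (width , (_ ∷ fresh) ∷ _ ∷ distinct) =
  ℕₚ.suc-injective width , fresh ∷ distinct

oddClauses : ∀ t → CNF (twice (suc t))
oddClauses t = map dropSecond (pairClauses (suc t))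

length-oddClauses : ∀ t → length (oddClauses t) ≡ 2 ^ suc t
length-oddClauses t = trans (length-map dropSecond (pairClauses (suc t))) (length-pairClauses (suc t))

oddClauses-uniform : ∀ t → Uniform (suc (twice t)) (oddClauses t)
oddClauses-uniform t = AllP.map⁺ (All.map dropSecond-uniform (pairClauses-uniform (suc t)))

oddClauses-FWins : ∀ t → FWins (oddClauses t) T empty
oddClauses-FWins t = FWins-empty (oddClauses t) λ a full mirrored →
  falsified⇒¬Sat (AnyP.map⁺ (Any.map All-dropSecond (pairClauses-falsified (suc t) a full mirrored)))
  where open PairingStrategy (swapPairs {suc t}) swapPairs-involutive swapPairs-≢

lemma6 : ∀ (k : ℕ) → 1 ≤ k → Odd k →
    ∃[ n ] ∃[ φ ] (Even n × Uniform {n} k φ × FWins φ T empty × length φ * length φ ≤ 2 ^ (k + 1))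
lemma6 k _ (t , refl) =
  twice (suc t) , oddClauses t , (suc t , twice≡2* (suc t)) ,
  subst (λ w → Uniform w (oddClauses t)) width (oddClauses-uniform t) ,
  oddClauses-FWins t , ≤-reflexive size
  where
  width : suc (twice t) ≡ 2 * t + 1
  width = trans (cong suc (twice≡2* t)) (ℕₚ.+-comm 1 (2 * t))
  exponent : ∀ t → suc t + suc t ≡ 2 * t + 1 + 1
  exponent = solve-∀
  size : length (oddClauses t) * length (oddClauses t) ≡ 2 ^ (2 * t + 1 + 1)
  size = begin
    length (oddClauses t) * length (oddClauses t) ≡⟨ cong₂ _*_ (length-oddClauses t) (length-oddClauses t) ⟩
    2 ^ suc t * 2 ^ suc t                          ≡⟨ sym (^-distribˡ-+-* 2 (suc t) (suc t)) ⟩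
    2 ^ (suc t + suc t)                            ≡⟨ cong (2 ^_) (exponent t) ⟩
    2 ^ (2 * t + 1 + 1)                            ∎
    where open ≡-Reasoning
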